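{- For all non-negative integers $n$ and $r$, \[ h_{n+1}^{(r)}=\sum_{k=0}^{n}\binom{n+r}{k+r}\frac{(-1)^{k}}{k+1}. \]
   Context: For an integer $r$ and an integer $n\ge 0$, the hyperharmonic number $h_n^{(r)}$ is the coefficient of $t^n$ in the power series expansion of $\frac{ -\ln(1-t)}{(1-t)^r}$. For $r\ge 1$ this agrees with the recursive definition $h_n^{(r)}=\sum_{k=1}^n h_k^{(r-1)}$, $h_k^{(0)}=1/k$ ($k\ge1$); in particular $h_0^{(r)}=0$. -}

module Defs where

open import Data.Nat using (ℕ; zero; suc)
open import Data.Integer using (ℤ; +_)
open import Data.Rational using (ℚ; 0ℚ; 1ℚ; _+_; _*_; -_; 1/_; _/_)

Σ≤ : ℕ → (ℕ → ℚ) → ℚ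
Σ≤ zero    f = f 0
Σ≤ (suc n) f = Σ≤ n f + f (suc n)

inv-suc : ℕ → ℚ
inv-suc k = (+ 1) / suc k

-- hyperharmonic numbers h n r = h_n^{(r)} for r ≥ 0:
-- h_0^{(r)} = 0, h_n^{(0)} = 1/n (n ≥ 1), h_n^{(r+1)} = sum_{k=1}^n h_k^{(r)}
-- sum_{k=1}^{n} f k  (empty sum = 0)
Σ₁ : ℕ → (ℕ → ℚ) → ℚ
Σ₁ zero    f = 0ℚ
Σ₁ (suc n) f = Σ₁ n f + f (suc n)

hyper : ℕ → ℕ → ℚ
hyper zero    r       = 0ℚ
hyper (suc n) zero    = inv-suc n
hyper (suc n) (suc r) = Σ₁ (suc n) (λ k → hyper k r)

sign : ℕ → ℚ
sign zero    = 1ℚ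
sign (suc k) = - sign k

{-# OPTIONS --safe #-}
-- Write S(n, r) for the right-hand side. Splitting the binomial coefficient of S(n+1, r+1) by
-- Pascal's rule gives S(n+1, r+1) = S(n, r+1) + S(n+1, r), which is also the recursion
-- h_{n+2}^{(r+1)} = h_{n+1}^{(r+1)} + h_{n+2}^{(r)} of the hyperharmonic numbers, so it suffices to
-- compare the boundary values. For n = 0 both sides equal 1. For r = 0 the absorption identity
-- (k+1) C(n+1,k+1) = (n+1) C(n,k) rewrites S(n, 0) as 1/(n+1) times the alternating sum
-- Σ_k (-1)^k C(n+1,k+1), which telescopes to 1 because C(n+1,k+1) = C(n,k) + C(n,k+1).
module Submission where

open import Data.Nat.Base as ℕ using (ℕ; zero; suc)
import Data.Nat.Properties as ℕ
import Data.Nat.Tactic.RingSolver as ℕ-Solver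
open import Data.Nat.Combinatorics using (_C_; nCk+nC[k+1]≡[n+1]C[k+1]; k>n⇒nCk≡0; nCn≡1; nC1≡n)
import Data.Integer as ℤ
open import Data.Integer using (+_)
open import Data.Integer.Properties using (pos-+; pos-*)
open import Data.Integer.Tactic.RingSolver using (solve-∀)
open import Data.Rational using (ℚ; 0ℚ; 1ℚ; _+_; _*_; _-_; _/_; toℚᵘ)
open import Data.Rational.Properties
  using (toℚᵘ-injective; toℚᵘ-fromℚᵘ; toℚᵘ-homo-+; toℚᵘ-homo-*; +-identityˡ; +-identityʳ; *-identityʳ; *-comm; *-assoc; *-distribˡ-+)
open import Data.Rational.Solver using (module +-*-Solver)
import Data.Rational.Unnormalised as ℚᵘ
open import Data.Rational.Unnormalised using (mkℚᵘ; _≃_; *≡*)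
open import Data.Rational.Unnormalised.Properties using (+-cong; *-cong; module ≃-Reasoning)
open import Relation.Binary.PropositionalEquality using (_≡_; refl; sym; trans; cong; cong₂; module ≡-Reasoning)
open import Defs

open +-*-Solver using (solve; _:+_; _:*_; :-_; _:-_; _:=_; con)

fromℕ : ℕ → ℚ
fromℕ n = + n / 1

toℚᵘ-fromℕ : ∀ n → toℚᵘ (fromℕ n) ≃ mkℚᵘ (+ n) 0
toℚᵘ-fromℕ n = toℚᵘ-fromℚᵘ (mkℚᵘ (+ n) 0)

fromℕ-+ : ∀ m n → fromℕ (m ℕ.+ n) ≡ fromℕ m + fromℕ n
fromℕ-+ m n = toℚᵘ-injective (begin
  toℚᵘ (fromℕ (m ℕ.+ n))             ≈⟨ toℚᵘ-fromℕ (m ℕ.+ n) ⟩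
  mkℚᵘ (+ (m ℕ.+ n)) 0               ≈⟨ *≡* (trans (cong (ℤ._* + 1) (pos-+ m n)) (cross-multiplied (+ m) (+ n))) ⟩
  mkℚᵘ (+ m) 0 ℚᵘ.+ mkℚᵘ (+ n) 0     ≈⟨ +-cong (toℚᵘ-fromℕ m) (toℚᵘ-fromℕ n) ⟨
  toℚᵘ (fromℕ m) ℚᵘ.+ toℚᵘ (fromℕ n) ≈⟨ toℚᵘ-homo-+ (fromℕ m) (fromℕ n) ⟨
  toℚᵘ (fromℕ m + fromℕ n)           ∎)
  where
  open ≃-Reasoning
  cross-multiplied : ∀ i j → (i ℤ.+ j) ℤ.* + 1 ≡ (i ℤ.* + 1 ℤ.+ j ℤ.* + 1) ℤ.* + 1
  cross-multiplied = solve-∀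

fromℕ-* : ∀ m n → fromℕ (m ℕ.* n) ≡ fromℕ m * fromℕ n
fromℕ-* m n = toℚᵘ-injective (begin
  toℚᵘ (fromℕ (m ℕ.* n))             ≈⟨ toℚᵘ-fromℕ (m ℕ.* n) ⟩
  mkℚᵘ (+ (m ℕ.* n)) 0               ≈⟨ *≡* (cong (ℤ._* + 1) (pos-* m n)) ⟩
  mkℚᵘ (+ m) 0 ℚᵘ.* mkℚᵘ (+ n) 0     ≈⟨ *-cong (toℚᵘ-fromℕ m) (toℚᵘ-fromℕ n) ⟨
  toℚᵘ (fromℕ m) ℚᵘ.* toℚᵘ (fromℕ n) ≈⟨ toℚᵘ-homo-* (fromℕ m) (fromℕ n) ⟨
  toℚᵘ (fromℕ m * fromℕ n)           ∎)
  where open ≃-Reasoning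

fromℕ-suc*inv-suc : ∀ k → fromℕ (suc k) * inv-suc k ≡ 1ℚ
fromℕ-suc*inv-suc k = toℚᵘ-injective (begin
  toℚᵘ (fromℕ (suc k) * inv-suc k)              ≈⟨ toℚᵘ-homo-* (fromℕ (suc k)) (inv-suc k) ⟩
  toℚᵘ (fromℕ (suc k)) ℚᵘ.* toℚᵘ (inv-suc k)   ≈⟨ *-cong (toℚᵘ-fromℕ (suc k)) (toℚᵘ-fromℚᵘ (mkℚᵘ (+ 1) k)) ⟩
  mkℚᵘ (+ suc k) 0 ℚᵘ.* mkℚᵘ (+ 1) k          ≈⟨ *≡* (cross-multiplied (+ suc k)) ⟩
  ℚᵘ.1ℚᵘ                                        ∎)
  where
  open ≃-Reasoning
  cross-multiplied : ∀ i → (i ℤ.* + 1) ℤ.* + 1 ≡ + 1 ℤ.* (+ 1 ℤ.* i)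
  cross-multiplied = solve-∀

Σ≤-cong : ∀ n {f g : ℕ → ℚ} → (∀ k → f k ≡ g k) → Σ≤ n f ≡ Σ≤ n g
Σ≤-cong zero    f≡g = f≡g 0
Σ≤-cong (suc n) f≡g = cong₂ _+_ (Σ≤-cong n f≡g) (f≡g (suc n))

Σ≤-+-distrib : ∀ n (f g : ℕ → ℚ) → Σ≤ n (λ k → f k + g k) ≡ Σ≤ n f + Σ≤ n g
Σ≤-+-distrib zero    f g = refl
Σ≤-+-distrib (suc n) f g = begin
  Σ≤ n (λ k → f k + g k) + (f (suc n) + g (suc n)) ≡⟨ cong (_+ (f (suc n) + g (suc n))) (Σ≤-+-distrib n f g) ⟩
  Σ≤ n f + Σ≤ n g + (f (suc n) + g (suc n))        ≡⟨ solve 4 (λ a b x y → (a :+ b) :+ (x :+ y) := (a :+ x) :+ (b :+ y)) refl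
                                                        (Σ≤ n f) (Σ≤ n g) (f (suc n)) (g (suc n)) ⟩
  Σ≤ (suc n) f + Σ≤ (suc n) g                      ∎
  where open ≡-Reasoning

Σ≤-*-distribˡ : ∀ n x (f : ℕ → ℚ) → Σ≤ n (λ k → x * f k) ≡ x * Σ≤ n f
Σ≤-*-distribˡ zero    x f = refl
Σ≤-*-distribˡ (suc n) x f =
  trans (cong (_+ x * f (suc n)) (Σ≤-*-distribˡ n x f)) (sym (*-distribˡ-+ x (Σ≤ n f) (f (suc n))))

Σ≤-telescope : ∀ n (f : ℕ → ℚ) → Σ≤ n (λ k → f k - f (suc k)) ≡ f 0 - f (suc n)
Σ≤-telescope zero    f = refl
Σ≤-telescope (suc n) f = begin
  Σ≤ n (λ k → f k - f (suc k)) + (f (suc n) - f (suc (suc n))) ≡⟨ cong (_+ (f (suc n) - f (suc (suc n)))) (Σ≤-telescope n f) ⟩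
  f 0 - f (suc n) + (f (suc n) - f (suc (suc n)))              ≡⟨ solve 3 (λ a b c → (a :- b) :+ (b :- c) := a :- c) refl
                                                                    (f 0) (f (suc n)) (f (suc (suc n))) ⟩
  f 0 - f (suc (suc n))                                        ∎
  where open ≡-Reasoning

[k+1]*[n+1]C[k+1]≡[n+1]*nCk : ∀ n k → suc k ℕ.* (suc n C suc k) ≡ suc n ℕ.* (n C k)
[k+1]*[n+1]C[k+1]≡[n+1]*nCk zero    zero    = refl
[k+1]*[n+1]C[k+1]≡[n+1]*nCk zero    (suc k) = ℕ.*-zeroʳ (suc (suc k))
[k+1]*[n+1]C[k+1]≡[n+1]*nCk (suc n) zero    = trans (ℕ.+-identityʳ _) (trans (nC1≡n (suc (suc n))) (sym (ℕ.*-identityʳ _)))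
[k+1]*[n+1]C[k+1]≡[n+1]*nCk (suc n) (suc k) = begin
  suc (suc k) ℕ.* (suc (suc n) C suc (suc k)) ≡⟨ cong (suc (suc k) ℕ.*_) (nCk+nC[k+1]≡[n+1]C[k+1] (suc n) (suc k)) ⟨
  suc (suc k) ℕ.* (X ℕ.+ Y)                   ≡⟨ regroup₁ k X Y ⟩
  suc k ℕ.* X ℕ.+ X ℕ.+ suc (suc k) ℕ.* Y     ≡⟨ cong₂ (λ a b → a ℕ.+ X ℕ.+ b) ([k+1]*[n+1]C[k+1]≡[n+1]*nCk n k)
                                                                             ([k+1]*[n+1]C[k+1]≡[n+1]*nCk n (suc k)) ⟩
  suc n ℕ.* P ℕ.+ X ℕ.+ suc n ℕ.* Q           ≡⟨ regroup₂ n P Q X ⟩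
  suc n ℕ.* (P ℕ.+ Q) ℕ.+ X                   ≡⟨ cong (λ z → suc n ℕ.* z ℕ.+ X) (nCk+nC[k+1]≡[n+1]C[k+1] n k) ⟩
  suc n ℕ.* X ℕ.+ X                           ≡⟨ ℕ.+-comm (suc n ℕ.* X) X ⟩
  suc (suc n) ℕ.* X                           ∎
  where
  open ≡-Reasoning
  X Y P Q : ℕ
  X = suc n C suc k
  Y = suc n C suc (suc k)
  P = n C k
  Q = n C suc k
  regroup₁ : ∀ k X Y → suc (suc k) ℕ.* (X ℕ.+ Y) ≡ suc k ℕ.* X ℕ.+ X ℕ.+ suc (suc k) ℕ.* Y
  regroup₁ = ℕ-Solver.solve-∀
  regroup₂ : ∀ n P Q X → suc n ℕ.* P ℕ.+ X ℕ.+ suc n ℕ.* Q ≡ suc n ℕ.* (P ℕ.+ Q) ℕ.+ X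
  regroup₂ = ℕ-Solver.solve-∀

fromℕ-absorption : ∀ n k → fromℕ (n C k) * inv-suc k ≡ inv-suc n * fromℕ (suc n C suc k)
fromℕ-absorption n k = begin
  x * i                   ≡⟨ solve 2 (λ x i → x :* i := con 1ℚ :* x :* i) refl x i ⟩
  1ℚ * x * i              ≡⟨ cong (λ z → z * x * i) (trans (*-comm (inv-suc n) b) (fromℕ-suc*inv-suc n)) ⟨
  inv-suc n * b * x * i   ≡⟨ solve 4 (λ c b x i → c :* b :* x :* i := c :* (b :* x) :* i) refl (inv-suc n) b x i ⟩
  inv-suc n * (b * x) * i ≡⟨ cong (λ z → inv-suc n * z * i) b*x≡a*y ⟩
  inv-suc n * (a * y) * i ≡⟨ solve 4 (λ c a y i → c :* (a :* y) :* i := c :* y :* (a :* i)) refl (inv-suc n) a y i ⟩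
  inv-suc n * y * (a * i) ≡⟨ cong (inv-suc n * y *_) (fromℕ-suc*inv-suc k) ⟩
  inv-suc n * y * 1ℚ      ≡⟨ *-identityʳ (inv-suc n * y) ⟩
  inv-suc n * y           ∎
  where
  open ≡-Reasoning
  a b x y i : ℚ
  a = fromℕ (suc k)
  b = fromℕ (suc n)
  x = fromℕ (n C k)
  y = fromℕ (suc n C suc k)
  i = inv-suc k
  b*x≡a*y : b * x ≡ a * y
  b*x≡a*y = begin
    b * x                             ≡⟨ fromℕ-* (suc n) (n C k) ⟨
    fromℕ (suc n ℕ.* (n C k))         ≡⟨ cong fromℕ ([k+1]*[n+1]C[k+1]≡[n+1]*nCk n k) ⟨
    fromℕ (suc k ℕ.* (suc n C suc k)) ≡⟨ fromℕ-* (suc k) (suc n C suc k) ⟩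
    a * y                             ∎

Σ≤-alternating-C-suc : ∀ n → Σ≤ n (λ k → fromℕ (suc n C suc k) * sign k) ≡ 1ℚ
Σ≤-alternating-C-suc n = begin
  Σ≤ n (λ k → fromℕ (suc n C suc k) * sign k) ≡⟨ Σ≤-cong n C-pascal ⟩
  Σ≤ n (λ k → a k - a (suc k))                 ≡⟨ Σ≤-telescope n a ⟩
  a 0 - a (suc n)                              ≡⟨ cong (λ z → a 0 - fromℕ z * sign (suc n)) (k>n⇒nCk≡0 (ℕ.n<1+n n)) ⟩
  1ℚ * 1ℚ - 0ℚ * sign (suc n)                  ≡⟨ solve 1 (λ s → con 1ℚ :* con 1ℚ :- con 0ℚ :* s := con 1ℚ) refl (sign (suc n)) ⟩
  1ℚ                                           ∎
  where
  open ≡-Reasoning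
  a : ℕ → ℚ
  a j = fromℕ (n C j) * sign j
  C-pascal : ∀ k → fromℕ (suc n C suc k) * sign k ≡ a k - a (suc k)
  C-pascal k = begin
    fromℕ (suc n C suc k) * sign k                ≡⟨ cong (λ z → fromℕ z * sign k) (nCk+nC[k+1]≡[n+1]C[k+1] n k) ⟨
    fromℕ (n C k ℕ.+ n C suc k) * sign k          ≡⟨ cong (_* sign k) (fromℕ-+ (n C k) (n C suc k)) ⟩
    (fromℕ (n C k) + fromℕ (n C suc k)) * sign k  ≡⟨ solve 3 (λ x y s → (x :+ y) :* s := x :* s :- y :* (:- s)) refl
                                                       (fromℕ (n C k)) (fromℕ (n C suc k)) (sign k) ⟩
    a k - a (suc k)                               ∎

Σ≤-alternating-C-harmonic : ∀ n → Σ≤ n (λ k → fromℕ (n C k) * sign k * inv-suc k) ≡ inv-suc n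
Σ≤-alternating-C-harmonic n = begin
  Σ≤ n (λ k → fromℕ (n C k) * sign k * inv-suc k)           ≡⟨ Σ≤-cong n absorb ⟩
  Σ≤ n (λ k → inv-suc n * (fromℕ (suc n C suc k) * sign k)) ≡⟨ Σ≤-*-distribˡ n (inv-suc n) _ ⟩
  inv-suc n * Σ≤ n (λ k → fromℕ (suc n C suc k) * sign k)   ≡⟨ cong (inv-suc n *_) (Σ≤-alternating-C-suc n) ⟩
  inv-suc n * 1ℚ                                             ≡⟨ *-identityʳ (inv-suc n) ⟩
  inv-suc n                                                  ∎
  where
  open ≡-Reasoning
  absorb : ∀ k → fromℕ (n C k) * sign k * inv-suc k ≡ inv-suc n * (fromℕ (suc n C suc k) * sign k)
  absorb k = begin
    fromℕ (n C k) * sign k * inv-suc k             ≡⟨ solve 3 (λ x s i → x :* s :* i := x :* i :* s) refl (fromℕ (n C k)) (sign k) (inv-suc k) ⟩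
    fromℕ (n C k) * inv-suc k * sign k             ≡⟨ cong (_* sign k) (fromℕ-absorption n k) ⟩
    inv-suc n * fromℕ (suc n C suc k) * sign k     ≡⟨ *-assoc (inv-suc n) (fromℕ (suc n C suc k)) (sign k) ⟩
    inv-suc n * (fromℕ (suc n C suc k) * sign k)   ∎

binomialHarmonicSum : ℕ → ℕ → ℚ
binomialHarmonicSum n r = Σ≤ n (λ k → fromℕ ((n ℕ.+ r) C (k ℕ.+ r)) * sign k * inv-suc k)

binomialHarmonicSum-pascal : ∀ m r →
  binomialHarmonicSum (suc m) (suc r) ≡ binomialHarmonicSum m (suc r) + binomialHarmonicSum (suc m) r
binomialHarmonicSum-pascal m r = begin
  binomialHarmonicSum (suc m) (suc r)                  ≡⟨ Σ≤-cong (suc m) split ⟩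
  Σ≤ (suc m) (λ k → t k + u k)                         ≡⟨ Σ≤-+-distrib (suc m) t u ⟩
  binomialHarmonicSum m (suc r) + t (suc m) + binomialHarmonicSum (suc m) r
                                                       ≡⟨ cong (λ z → binomialHarmonicSum m (suc r) + z + binomialHarmonicSum (suc m) r) t[1+m]≡0 ⟩
  binomialHarmonicSum m (suc r) + 0ℚ + binomialHarmonicSum (suc m) r
                                                       ≡⟨ cong (_+ binomialHarmonicSum (suc m) r) (+-identityʳ (binomialHarmonicSum m (suc r))) ⟩
  binomialHarmonicSum m (suc r) + binomialHarmonicSum (suc m) r ∎
  where
  open ≡-Reasoning
  t u : ℕ → ℚ
  t k = fromℕ ((m ℕ.+ suc r) C (k ℕ.+ suc r)) * sign k * inv-suc k
  u k = fromℕ ((suc m ℕ.+ r) C (k ℕ.+ r)) * sign k * inv-suc k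
  C-pascal : ∀ k → (suc m ℕ.+ suc r) C (k ℕ.+ suc r) ≡ (m ℕ.+ suc r) C (k ℕ.+ suc r) ℕ.+ (suc m ℕ.+ r) C (k ℕ.+ r)
  C-pascal k rewrite ℕ.+-suc m r | ℕ.+-suc k r =
    trans (sym (nCk+nC[k+1]≡[n+1]C[k+1] (suc (m ℕ.+ r)) (k ℕ.+ r))) (ℕ.+-comm (suc (m ℕ.+ r) C (k ℕ.+ r)) (suc (m ℕ.+ r) C suc (k ℕ.+ r)))
  split : ∀ k → fromℕ ((suc m ℕ.+ suc r) C (k ℕ.+ suc r)) * sign k * inv-suc k ≡ t k + u k
  split k = begin
    fromℕ ((suc m ℕ.+ suc r) C (k ℕ.+ suc r)) * sign k * inv-suc k  ≡⟨ cong (λ z → fromℕ z * sign k * inv-suc k) (C-pascal k) ⟩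
    fromℕ (x ℕ.+ y) * sign k * inv-suc k                             ≡⟨ cong (λ z → z * sign k * inv-suc k) (fromℕ-+ x y) ⟩
    (fromℕ x + fromℕ y) * sign k * inv-suc k                         ≡⟨ solve 4 (λ x y s i → (x :+ y) :* s :* i := x :* s :* i :+ y :* s :* i) refl
                                                                          (fromℕ x) (fromℕ y) (sign k) (inv-suc k) ⟩
    t k + u k                                                        ∎
    where
    x y : ℕ
    x = (m ℕ.+ suc r) C (k ℕ.+ suc r)
    y = (suc m ℕ.+ r) C (k ℕ.+ r)
  t[1+m]≡0 : t (suc m) ≡ 0ℚ
  t[1+m]≡0 = begin
    t (suc m)                                  ≡⟨ cong (λ z → fromℕ z * sign (suc m) * inv-suc (suc m)) (k>n⇒nCk≡0 (ℕ.n<1+n (m ℕ.+ suc r))) ⟩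
    0ℚ * sign (suc m) * inv-suc (suc m)        ≡⟨ solve 2 (λ s i → con 0ℚ :* s :* i := con 0ℚ) refl (sign (suc m)) (inv-suc (suc m)) ⟩
    0ℚ                                         ∎

hyper≡binomialHarmonicSum : ∀ n r → hyper (suc n) r ≡ binomialHarmonicSum n r
hyper≡binomialHarmonicSum n       zero    = sym (begin
  binomialHarmonicSum n 0                          ≡⟨ Σ≤-cong n (λ k → cong₂ (λ a b → fromℕ (a C b) * sign k * inv-suc k) (ℕ.+-identityʳ n) (ℕ.+-identityʳ k)) ⟩
  Σ≤ n (λ k → fromℕ (n C k) * sign k * inv-suc k) ≡⟨ Σ≤-alternating-C-harmonic n ⟩
  inv-suc n                                        ∎)
  where open ≡-Reasoning
hyper≡binomialHarmonicSum zero    (suc r) = begin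
  0ℚ + hyper 1 r                              ≡⟨ +-identityˡ (hyper 1 r) ⟩
  hyper 1 r                                   ≡⟨ hyper≡binomialHarmonicSum zero r ⟩
  fromℕ (r C r) * 1ℚ * 1ℚ                     ≡⟨ cong (λ z → fromℕ z * 1ℚ * 1ℚ) (trans (nCn≡1 r) (sym (nCn≡1 (suc r)))) ⟩
  fromℕ (suc r C suc r) * 1ℚ * 1ℚ             ∎
  where open ≡-Reasoning
hyper≡binomialHarmonicSum (suc m) (suc r) = begin
  hyper (suc (suc m)) (suc r)                                   ≡⟨⟩
  hyper (suc m) (suc r) + hyper (suc (suc m)) r                 ≡⟨ cong₂ _+_ (hyper≡binomialHarmonicSum m (suc r)) (hyper≡binomialHarmonicSum (suc m) r) ⟩
  binomialHarmonicSum m (suc r) + binomialHarmonicSum (suc m) r ≡⟨ binomialHarmonicSum-pascal m r ⟨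
  binomialHarmonicSum (suc m) (suc r)                           ∎
  where open ≡-Reasoning

mainTheorem1 : ∀ (n r : ℕ) →
    hyper (n ℕ.+ 1) r ≡ Σ≤ n (λ k → ((+ ((n ℕ.+ r) C (k ℕ.+ r))) / 1) * sign k * inv-suc k)
mainTheorem1 n r rewrite ℕ.+-comm n 1 = hyper≡binomialHarmonicSum n r
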